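{- Let $G=(V,E)$ be a finite simple graph and $S\subseteq V$. The following are equivalent: (1) there exists a word $w$ with $[w]=S$ that fixes $F_G$; (2) for all words $w^{p},w^{s}$ with $[w^{p}]=[w^{s}]=S$, the concatenation $w^{p}w^{s}$ fixes $F_G$; (3) $S$ is a vertex cover of $G$ and a non-district of $G$.
   Context: The MIS network of $G$ is $F_G(x)_v=\bigwedge_{u\in N(v)}\neg x_u$ for $x\in\{0,1\}^V$ (with value $1$ if $v$ has no neighbours), $N(v)$ the open neighbourhood. $F_G^v$ updates only coordinate $v$ to $F_G(x)_v$; for a word $w=w_1\dots w_l\in V^*$, $F_G^w=F_G^{w_l}\circ\dots\circ F_G^{w_1}$, and $[w]$ is the set of vertices occurring in $w$. A word $w$ fixes $F_G$ if $F_G^w(x)$ is a fixed point of $F_G$ (equivalently, the characteristic vector of a maximal independent set) for every $x$. A set $S$ is a constituency of a graph $H$ if there is an independent set $I$ of $H$ with $S\subseteq N(I)$. A set $T$ is a district of $G$ if there exists $v\in V\setminus T$ such that $T\cap N(v)$ is a constituency of $G-v$; a non-district is a set that is not a district. -}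

module Defs where

open import Data.Bool using (Bool; true; false; not; _∧_; if_then_else_)
open import Data.Nat using (ℕ)
open import Data.Fin using (Fin; _≟_)
open import Data.Fin.Subset using (Subset; _∈_; _∉_; _∩_)
open import Data.List using (List; foldl; map; allFin)
open import Data.Bool.ListAction using (and)
open import Data.List.Membership.Propositional using () renaming (_∈_ to _∈ₗ_)
open import Data.Vec using (tabulate)
open import Data.Product using (Σ; ∃; _×_)
open import Data.Sum using (_⊎_)
open import Function.Bundles using (_⇔_)
open import Relation.Nullary using (¬_; does)
open import Relation.Binary.PropositionalEquality using (_≡_)

record Graph (n : ℕ) : Set where
  field
    adj    : Fin n → Fin n → Bool
    sym    : ∀ u v → adj u v ≡ adj v u
    irrefl : ∀ v → adj v v ≡ false
open Graph public

module _ {n : ℕ} (G : Graph n) where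

  -- the MIS network: F_G(x)_v = ⋀_{u ∈ N(v)} ¬ x_u  (true if N(v) = ∅)
  F : (Fin n → Bool) → Fin n → Bool
  F x v = and (map (λ u → not (adj G v u ∧ x u)) (allFin n))

  Fᵛ : Fin n → (Fin n → Bool) → Fin n → Bool
  Fᵛ v x u = if does (u ≟ v) then F x v else x u

  Fʷ : List (Fin n) → (Fin n → Bool) → Fin n → Bool
  Fʷ w x = foldl (λ y v → Fᵛ v y) x w

  IsFixedPoint : (Fin n → Bool) → Set
  IsFixedPoint y = ∀ v → F y v ≡ y v

  Fixes : List (Fin n) → Set
  Fixes w = ∀ (x : Fin n → Bool) → IsFixedPoint (Fʷ w x)

  N : Fin n → Subset n
  N v = tabulate (adj G v)

  VertexCover : Subset n → Set
  VertexCover S = ∀ u v → adj G u v ≡ true → u ∈ S ⊎ v ∈ S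

  Independent : Subset n → Set
  Independent I = ∀ i j → i ∈ I → j ∈ I → adj G i j ≡ false

  -- A is a constituency of G - v: there is an independent set I of G - v
  -- (i.e. independent in G, not containing v) with A ⊆ N_{G-v}(I)
  -- (in particular A ⊆ V ∖ {v}).
  ConstituencyDel : Fin n → Subset n → Set
  ConstituencyDel v A =
    Σ (Subset n) λ I → v ∉ I × Independent I ×
      (∀ a → a ∈ A → ¬ (a ≡ v) × ∃ λ i → i ∈ I × adj G a i ≡ true)

  District : Subset n → Set
  District T = ∃ λ v → v ∉ T × ConstituencyDel v (T ∩ N v)

  NonDistrict : Subset n → Set
  NonDistrict T = ¬ District T

Occ≡ : {n : ℕ} → List (Fin n) → Subset n → Set
Occ≡ {n} w S = ∀ (v : Fin n) → (v ∈ₗ w) ⇔ (v ∈ S)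

{-# OPTIONS --safe #-}
-- Call u locked in a configuration y if y_u = 1 forces y_a = 0 for every neighbour a.
-- Updating u locks it, locked vertices stay locked, and updating a locked vertex never
-- destroys F(y)_u = y_u at another vertex u. So after w^p every vertex of S is locked, and
-- after w^s every vertex of S is moreover fixed. If S is a vertex cover, every vertex is
-- then locked, i.e. the support of y is independent, and a vertex v ∉ S with y_v = 0 but
-- F(y)_v = 1 would make S a district, S ∩ N(v) being dominated by that support.
-- Conversely, vertices outside [w] are never updated: starting from all ones this rules out
-- an edge outside S, and starting from the characteristic vector of the independent set I
-- of a district (whose vertices, being locked, stay on) it leaves the district's vertex v
-- at 0 while all its neighbours, lying in S ∩ N(v) ⊆ N(I), are 0.
module Submission where

open import Defs
open import Data.Nat using (ℕ)
open import Data.Fin.Subset using (Subset)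
open import Data.List using (List; _++_)
open import Data.Fin using (Fin)
open import Data.Product using (∃; _×_)
open import Function.Bundles using (_⇔_)

open import Data.Bool using (Bool; true; false; not; _∧_; T)
open import Data.Bool.Properties using (T-≡; not-¬; ¬-not)
open import Data.Bool.ListAction using (and)
open import Data.Fin using (_≟_)
open import Data.Fin.Subset using (_∈_; _∉_; _∩_)
open import Data.Fin.Subset.Properties using (_∈?_; x∈p∩q⁺; x∈p∩q⁻)
open import Data.List using ([]; _∷_; allFin; filter)
open import Data.List.Properties using (foldl-++; map-cong)
open import Data.List.Membership.Propositional using () renaming (_∈_ to _∈ₗ_; _∉_ to _∉ₗ_)
open import Data.List.Membership.Propositional.Properties using (∈-allFin; ∈-filter⁺; ∈-filter⁻; ∈-++⁺ˡ; ∈-++⁻)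
open import Data.List.Relation.Unary.All as All using (All; []; _∷_)
open import Data.List.Relation.Unary.All.Properties using (all⁺; all⁻; ¬All⇒Any¬)
open import Data.List.Relation.Unary.Any as Any using (here; there)
open import Data.Vec using (tabulate; lookup)
open import Data.Vec.Properties using (lookup∘tabulate; []=⇒lookup; lookup⇒[]=)
open import Data.Product using (_,_; proj₂)
open import Data.Sum using (_⊎_; inj₁; inj₂; [_,_]′)
open import Function using (_∘_; id; flip)
open import Function.Bundles using (mk⇔; Equivalence)
open import Relation.Nullary using (¬_; contradiction)
open import Relation.Nullary.Decidable using (yes; no; dec-true; dec-false; T?)
open import Relation.Binary.PropositionalEquality as ≡ using (_≡_; _≢_; refl; trans; cong; subst)

open Equivalence using (to; from)

T-nand⇔ : ∀ a b → T (not (a ∧ b)) ⇔ (a ≡ true → b ≡ false)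
T-nand⇔ false _     = mk⇔ (λ _ ()) _
T-nand⇔ true  false = mk⇔ (λ _ _ → refl) _
T-nand⇔ true  true  = mk⇔ (λ ()) (λ h → contradiction (h refl) λ ())

¬T-nand : ∀ a b → ¬ T (not (a ∧ b)) → a ≡ true × b ≡ true
¬T-nand true  true  _ = refl , refl
¬T-nand true  false h = contradiction _ h
¬T-nand false _     h = contradiction _ h

∈-tabulate⇔ : ∀ {n} (f : Fin n → Bool) i → i ∈ tabulate f ⇔ f i ≡ true
∈-tabulate⇔ f i = mk⇔ (λ i∈f → trans (≡.sym (lookup∘tabulate f i)) ([]=⇒lookup i∈f))
                      (λ fi → lookup⇒[]= i _ (trans (lookup∘tabulate f i) fi))

[_]⊆_ : ∀ {n} → List (Fin n) → Subset n → Set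
[ w ]⊆ S = ∀ {v} → v ∈ₗ w → v ∈ S

Occ≡-++ : ∀ {n} {w w′ : List (Fin n)} {S} → Occ≡ w S → Occ≡ w′ S → Occ≡ (w ++ w′) S
Occ≡-++ {w = w} w≡S w′≡S v =
  mk⇔ ([ to (w≡S v) , to (w′≡S v) ]′ ∘ ∈-++⁻ w) (∈-++⁺ˡ ∘ from (w≡S v))

enumerate : ∀ {n} → Subset n → List (Fin n)
enumerate {n} S = filter (_∈? S) (allFin n)

Occ≡-enumerate : ∀ {n} (S : Subset n) → Occ≡ (enumerate S) S
Occ≡-enumerate {n} S v =
  mk⇔ (proj₂ ∘ ∈-filter⁻ (_∈? S) {xs = allFin n}) (∈-filter⁺ (_∈? S) (∈-allFin v))

module _ {n : ℕ} (G : Graph n) where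

  adj⇒≢ : ∀ {u a} → adj G u a ≡ true → a ≢ u
  adj⇒≢ {u} ua refl = contradiction (trans (≡.sym ua) (irrefl G u)) λ ()

  neighbour∈cover : ∀ {S v a} → VertexCover G S → v ∉ S → adj G v a ≡ true → a ∈ S
  neighbour∈cover vc v∉S va = [ flip contradiction v∉S , id ]′ (vc _ _ va)

  private
    nand : (Fin n → Bool) → Fin n → Fin n → Bool
    nand y v u = not (adj G v u ∧ y u)

  F≡true⁻ : ∀ {y v} → F G y v ≡ true → ∀ u → adj G v u ≡ true → y u ≡ false
  F≡true⁻ {y} {v} Fv u = to (T-nand⇔ (adj G v u) (y u))
    (All.lookup (all⁺ (nand y v) (allFin n) (from T-≡ Fv)) (∈-allFin u))

  F≡true⁺ : ∀ {y v} → (∀ u → adj G v u ≡ true → y u ≡ false) → F G y v ≡ true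
  F≡true⁺ {y} {v} off = to T-≡
    (all⁻ (nand y v) {allFin n} (All.tabulate λ {u} _ → from (T-nand⇔ (adj G v u) (y u)) (off u)))

  F≡false⁻ : ∀ {y v} → F G y v ≡ false → ∃ λ u → adj G v u ≡ true × y u ≡ true
  F≡false⁻ {y} {v} Fv
    with Any.satisfied (¬All⇒Any¬ (T? ∘ nand y v) (allFin n) (subst T Fv ∘ all⁻ (nand y v)))
  ... | u , ¬nand = u , ¬T-nand (adj G v u) (y u) ¬nand

  F≡false⁺ : ∀ {y v u} → adj G v u ≡ true → y u ≡ true → F G y v ≡ false
  F≡false⁺ {u = u} vu yu = ¬-not λ Fv → not-¬ yu (F≡true⁻ Fv u vu)

  F-cong : ∀ {y z} v → (∀ u → adj G v u ≡ true → y u ≡ z u) → F G y v ≡ F G z v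
  F-cong {y} {z} v y≈z = cong and (map-cong agree (allFin n))
    where
      agree : ∀ u → nand y v u ≡ nand z v u
      agree u with adj G v u in vu
      ... | true  = cong not (y≈z u vu)
      ... | false = refl

  Fᵛ-self : ∀ p y → Fᵛ G p y p ≡ F G y p
  Fᵛ-self p y rewrite dec-true (p ≟ p) refl = refl

  Fᵛ-other : ∀ {p u} y → u ≢ p → Fᵛ G p y u ≡ y u
  Fᵛ-other {p} {u} y u≢p rewrite dec-false (u ≟ p) u≢p = refl

  Fᵛ-cases : ∀ p y u → (u ≡ p × Fᵛ G p y u ≡ F G y p) ⊎ Fᵛ G p y u ≡ y u
  Fᵛ-cases p y u with u ≟ p
  ... | yes refl = inj₁ (refl , refl)
  ... | no _     = inj₂ refl

  Fʷ-++ : ∀ w w′ x → Fʷ G (w ++ w′) x ≡ Fʷ G w′ (Fʷ G w x)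
  Fʷ-++ w w′ x = foldl-++ (λ y v → Fᵛ G v y) x w w′

  Fʷ-∉ : ∀ {u} w x → u ∉ₗ w → Fʷ G w x u ≡ x u
  Fʷ-∉ []      x u∉w = refl
  Fʷ-∉ (p ∷ w) x u∉w = trans (Fʷ-∉ w (Fᵛ G p x) (u∉w ∘ there)) (Fᵛ-other x (u∉w ∘ here))

  Locked : (Fin n → Bool) → Fin n → Set
  Locked y u = y u ≡ true → ∀ a → adj G u a ≡ true → y a ≡ false

  Satisfied : (Fin n → Bool) → Fin n → Set
  Satisfied y u = F G y u ≡ y u

  Fᵛ-keeps-on : ∀ p y {u} → Locked y p → y u ≡ true → Fᵛ G p y u ≡ true
  Fᵛ-keeps-on p y {u} Lp yu with Fᵛ-cases p y u
  ... | inj₁ (refl , updated) = trans updated (F≡true⁺ (Lp yu))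
  ... | inj₂ unchanged        = trans unchanged yu

  Fᵛ-keeps-off : ∀ p y {u a} → y u ≡ true → adj G u a ≡ true → y a ≡ false → Fᵛ G p y a ≡ false
  Fᵛ-keeps-off p y {u} {a} yu ua ya with Fᵛ-cases p y a
  ... | inj₁ (refl , updated) = trans updated (F≡false⁺ (trans (sym G a u) ua) yu)
  ... | inj₂ unchanged        = trans unchanged ya

  Fᵛ-locks : ∀ p y → Locked (Fᵛ G p y) p
  Fᵛ-locks p y on a pa =
    trans (Fᵛ-other y (adj⇒≢ pa)) (F≡true⁻ (trans (≡.sym (Fᵛ-self p y)) on) a pa)

  Fᵛ-keeps-locked : ∀ p y {u} → Locked y u → Locked (Fᵛ G p y) u
  Fᵛ-keeps-locked p y {u} Lu with Fᵛ-cases p y u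
  ... | inj₁ (refl , _)       = Fᵛ-locks u y
  ... | inj₂ unchanged        = λ on a ua →
    let yu = trans (≡.sym unchanged) on in Fᵛ-keeps-off p y yu ua (Lu yu a ua)

  Fᵛ-satisfies : ∀ p y → Satisfied (Fᵛ G p y) p
  Fᵛ-satisfies p y = trans (F-cong p λ a pa → Fᵛ-other y (adj⇒≢ pa)) (≡.sym (Fᵛ-self p y))

  Fᵛ-keeps-satisfied : ∀ p y {u} → Locked y p → Satisfied y u → Satisfied (Fᵛ G p y) u
  Fᵛ-keeps-satisfied p y {u} Lp sat with Fᵛ-cases p y u
  ... | inj₁ (refl , _)       = Fᵛ-satisfies u y
  ... | inj₂ unchanged        = trans (F-after (y u) refl) (≡.sym unchanged)
    where
      F-after : ∀ b → y u ≡ b → F G (Fᵛ G p y) u ≡ b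
      F-after true  yu = F≡true⁺ λ a ua → Fᵛ-keeps-off p y yu ua (F≡true⁻ (trans sat yu) a ua)
      F-after false yu with F≡false⁻ (trans sat yu)
      ... | a , ua , ya = F≡false⁺ ua (Fᵛ-keeps-on p y Lp ya)

  Fʷ-keeps-locked : ∀ w y {u} → Locked y u → Locked (Fʷ G w y) u
  Fʷ-keeps-locked []      y Lu = Lu
  Fʷ-keeps-locked (p ∷ w) y Lu = Fʷ-keeps-locked w (Fᵛ G p y) (Fᵛ-keeps-locked p y Lu)

  Fʷ-locks : ∀ w y {u} → u ∈ₗ w → Locked (Fʷ G w y) u
  Fʷ-locks (p ∷ w) y (here refl) = Fʷ-keeps-locked w (Fᵛ G p y) (Fᵛ-locks p y)
  Fʷ-locks (p ∷ w) y (there u∈w) = Fʷ-locks w (Fᵛ G p y) u∈w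

  Fʷ-keeps-on : ∀ w y {u} → (∀ v → Locked y v) → y u ≡ true → Fʷ G w y u ≡ true
  Fʷ-keeps-on []      y L yu = yu
  Fʷ-keeps-on (p ∷ w) y L yu =
    Fʷ-keeps-on w (Fᵛ G p y) (λ v → Fᵛ-keeps-locked p y (L v)) (Fᵛ-keeps-on p y (L p) yu)

  Fʷ-keeps-satisfied : ∀ w y {u} → All (Locked y) w → Satisfied y u → Satisfied (Fʷ G w y) u
  Fʷ-keeps-satisfied []      y []        sat = sat
  Fʷ-keeps-satisfied (p ∷ w) y (Lp ∷ Lw) sat =
    Fʷ-keeps-satisfied w (Fᵛ G p y) (All.map (Fᵛ-keeps-locked p y) Lw)
      (Fᵛ-keeps-satisfied p y Lp sat)

  Fʷ-satisfies : ∀ w y {u} → All (Locked y) w → u ∈ₗ w → Satisfied (Fʷ G w y) u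
  Fʷ-satisfies (p ∷ w) y (_ ∷ Lw) (here refl) =
    Fʷ-keeps-satisfied w (Fᵛ G p y) (All.map (Fᵛ-keeps-locked p y) Lw) (Fᵛ-satisfies p y)
  Fʷ-satisfies (p ∷ w) y (_ ∷ Lw) (there u∈w) =
    Fʷ-satisfies w (Fᵛ G p y) (All.map (Fᵛ-keeps-locked p y) Lw) u∈w

  locked⇒independent : ∀ {y} → (∀ v → Locked y v) → Independent G (tabulate y)
  locked⇒independent {y} L i j i∈ j∈ =
    ¬-not λ ij → not-¬ (to (∈-tabulate⇔ y j) j∈) (L i (to (∈-tabulate⇔ y i) i∈) j ij)

  independent⇒locked : ∀ {I} → Independent G I → ∀ v → Locked (lookup I) v
  independent⇒locked {I} indep v Iv a va =
    ¬-not λ Ia → not-¬ va (indep v a (lookup⇒[]= v I Iv) (lookup⇒[]= a I Ia))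

  cover-locked⇒locked : ∀ {S y} → VertexCover G S → (∀ {u} → u ∈ S → Locked y u) →
                        ∀ v → Locked y v
  cover-locked⇒locked {S} vc L v with v ∈? S
  ... | yes v∈S = L v∈S
  ... | no v∉S  = λ yv a va →
    ¬-not λ ya → not-¬ yv (L (neighbour∈cover vc v∉S va) ya v (trans (sym G a v) va))

  district-witness : ∀ {S z v} → (∀ u → Locked z u) → (∀ {u} → u ∈ S → Satisfied z u) →
                     v ∉ S → z v ≡ false → F G z v ≡ true → District G S
  district-witness {S} {z} {v} L sat v∉S zv Fv =
    v , v∉S , tabulate z , not-¬ zv ∘ to (∈-tabulate⇔ z v) , locked⇒independent L , covered
    where
      covered : ∀ a → a ∈ (S ∩ N G v) → a ≢ v × ∃ λ i → i ∈ tabulate z × adj G a i ≡ true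
      covered a a∈ =
        let a∈S , a∈N   = x∈p∩q⁻ S (N G v) a∈
            va          = to (∈-tabulate⇔ (adj G v) a) a∈N
            i , ai , zi = F≡false⁻ (trans (sat a∈S) (F≡true⁻ Fv a va))
        in adj⇒≢ va , i , from (∈-tabulate⇔ z i) zi , ai

  locked-satisfied⇒fixedPoint : ∀ {S z} → VertexCover G S → NonDistrict G S →
                                (∀ {u} → u ∈ S → Locked z u) → (∀ {u} → u ∈ S → Satisfied z u) →
                                IsFixedPoint G z
  locked-satisfied⇒fixedPoint {S} {z} vc nd L sat v with v ∈? S
  ... | yes v∈S = sat v∈S
  ... | no v∉S  = F-after (z v) refl
    where
      locked : ∀ u → Locked z u
      locked = cover-locked⇒locked vc L
      F-after : ∀ b → z v ≡ b → F G z v ≡ b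
      F-after true  zv = F≡true⁺ (locked v zv)
      F-after false zv = ¬-not λ Fv → nd (district-witness locked sat v∉S zv Fv)

  vertexCover×nonDistrict⇒fixes : ∀ {S} → VertexCover G S → NonDistrict G S →
                                  ∀ wp ws → (∀ {v} → v ∈ S → v ∈ₗ wp) → Occ≡ ws S →
                                  Fixes G (wp ++ ws)
  vertexCover×nonDistrict⇒fixes {S} vc nd wp ws S⊆wp ws≡S x =
    subst (IsFixedPoint G) (≡.sym (Fʷ-++ wp ws x))
      (locked-satisfied⇒fixedPoint vc nd locked satisfied)
    where
      y : Fin n → Bool
      y = Fʷ G wp x
      locked-y : ∀ {u} → u ∈ S → Locked y u
      locked-y u∈S = Fʷ-locks wp x (S⊆wp u∈S)
      locked : ∀ {u} → u ∈ S → Locked (Fʷ G ws y) u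
      locked u∈S = Fʷ-keeps-locked ws y (locked-y u∈S)
      satisfied : ∀ {u} → u ∈ S → Satisfied (Fʷ G ws y) u
      satisfied {u} u∈S =
        Fʷ-satisfies ws y (All.tabulate (locked-y ∘ to (ws≡S _))) (from (ws≡S u) u∈S)

  fixes⇒vertexCover : ∀ {S w} → [ w ]⊆ S → Fixes G w → VertexCover G S
  fixes⇒vertexCover {S} {w} w⊆S fixes u v uv with u ∈? S | v ∈? S
  ... | yes u∈S | _        = inj₁ u∈S
  ... | no _    | yes v∈S  = inj₂ v∈S
  ... | no u∉S  | no v∉S   =
    contradiction (trans (≡.sym (fixes all-on u)) (F≡false⁺ uv (stays-on v∉S)))
                  (not-¬ (stays-on u∉S))
    where
      all-on : Fin n → Bool
      all-on _ = true
      stays-on : ∀ {t} → t ∉ S → Fʷ G w all-on t ≡ true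
      stays-on t∉S = Fʷ-∉ w all-on (t∉S ∘ w⊆S)

  fixes⇒nonDistrict : ∀ {S w} → [ w ]⊆ S → Fixes G w → NonDistrict G S
  fixes⇒nonDistrict {S} {w} w⊆S fixes (v , v∉S , I , v∉I , indep , covered) =
    not-¬ (trans (≡.sym (fixes (lookup I) v)) (F≡true⁺ neighbours-off)) zv
    where
      z : Fin n → Bool
      z = Fʷ G w (lookup I)
      locked : ∀ u → Locked (lookup I) u
      locked = independent⇒locked indep
      zv : z v ≡ false
      zv = trans (Fʷ-∉ w (lookup I) (v∉S ∘ w⊆S)) (¬-not (v∉I ∘ lookup⇒[]= v I))
      neighbours-off : ∀ a → adj G v a ≡ true → z a ≡ false
      neighbours-off a va
        with covered a (x∈p∩q⁺ (neighbour∈cover (fixes⇒vertexCover w⊆S fixes) v∉S va ,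
                                from (∈-tabulate⇔ (adj G v) a) va))
      ... | _ , i , i∈I , ai =
        Fʷ-keeps-locked w (lookup I) (locked i) (Fʷ-keeps-on w (lookup I) locked ([]=⇒lookup i∈I))
          a (trans (sym G i a) ai)

proposition5p7 : ∀ {n : ℕ} (G : Graph n) (S : Subset n) →
    ((∃ λ (w : List (Fin n)) → Occ≡ w S × Fixes G w) ⇔
      (∀ (wp ws : List (Fin n)) → Occ≡ wp S → Occ≡ ws S → Fixes G (wp ++ ws)))
    × ((∀ (wp ws : List (Fin n)) → Occ≡ wp S → Occ≡ ws S → Fixes G (wp ++ ws)) ⇔
      (VertexCover G S × NonDistrict G S))
proposition5p7 {n} G S = mk⇔ (iii⇒ii ∘ i⇒iii) ii⇒i , mk⇔ (i⇒iii ∘ ii⇒i) iii⇒ii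
  where
    i ii iii : Set
    i   = ∃ λ (w : List (Fin n)) → Occ≡ w S × Fixes G w
    ii  = ∀ (wp ws : List (Fin n)) → Occ≡ wp S → Occ≡ ws S → Fixes G (wp ++ ws)
    iii = VertexCover G S × NonDistrict G S

    i⇒iii : i → iii
    i⇒iii (w , w≡S , fixes) =
      fixes⇒vertexCover G (to (w≡S _)) fixes , fixes⇒nonDistrict G (to (w≡S _)) fixes

    ii⇒i : ii → i
    ii⇒i fixes-++ = enumerate S ++ enumerate S , Occ≡-++ S≡S S≡S , fixes-++ _ _ S≡S S≡S
      where
        S≡S : Occ≡ (enumerate S) S
        S≡S = Occ≡-enumerate S

    iii⇒ii : iii → ii
    iii⇒ii (vc , nd) wp ws wp≡S = vertexCover×nonDistrict⇒fixes G vc nd wp ws (from (wp≡S _))
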